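{- Let $G$ be a graph with $\delta(G) > \frac{3}{4}v(G)$. If $A,B\subseteq V(G)$ with $|A\cup B|\le 4$, then $\hat{N}(A)+\hat{N}(B)-\hat{N}(A\cap B) > 0$.
   Context: For $S\subseteq V(G)$, the common neighbor density is $\hat{N}(S)=\frac{|\bigcap_{s\in S}N(s)|}{v(G)}$, where $N(s)$ is the neighbourhood of $s$ and the empty intersection is $V(G)$ (so $\hat N(\emptyset)=1$). -}

module Defs where

open import Data.Nat using (ℕ; suc; _+_; _*_; _≤_; _<_)
open import Data.Bool using (Bool; true; false)
open import Data.Fin using (Fin)
open import Data.Fin.Subset using (Subset; _∩_; _∪_; ⋂; ∣_∣)
open import Data.Vec using (lookup)
open import Data.Bool using (T?)
open import Data.Vec using (tabulate)
open import Data.Integer using (+_)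
open import Data.Rational using (ℚ; _/_)
open import Relation.Binary.PropositionalEquality using (_≡_)
import Data.List as L
open import Data.List using (List)

record Graph (n : ℕ) : Set where
  field
    adj   : Fin n → Fin n → Bool
    sym   : ∀ u v → adj u v ≡ adj v u
    irefl : ∀ v → adj v v ≡ false

open Graph public

vertices : (n : ℕ) → List (Fin n)
vertices n = L.allFin n

N : ∀ {n} → Graph n → Fin n → Subset n
N G v = tabulate (adj G v)

deg : ∀ {n} → Graph n → Fin n → ℕ
deg G v = ∣ N G v ∣

-- common neighbourhood ⋂_{s∈S} N(s); the empty intersection is V(G)
commonNbhd : ∀ {n} → Graph n → Subset n → Subset n
commonNbhd {n} G S = ⋂ (L.map (N G) (L.filter (λ s → T? (lookup S s)) (vertices n)))

Nhat : ∀ {m} → Graph (suc m) → Subset (suc m) → ℚ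
Nhat {m} G S = (+ ∣ commonNbhd G S ∣) / suc m

-- Double counting.  For a vertex v, each of "v ∉ N(A)", "v ∉ N(B)" is witnessed by
-- a non-neighbour of v in A ∪ B, and if v misses both N(A) and N(B) while lying in
-- N(A ∩ B) the two witnesses are distinct; hence
--   1 + [v ∈ N(A ∩ B)] ≤ [v ∈ N(A)] + [v ∈ N(B)] + #{s ∈ A ∪ B : s ≁ v}.
-- Summing over v gives  n + |N(A ∩ B)| ≤ |N(A)| + |N(B)| + Σ_{s ∈ A ∪ B} (n − deg s),
-- and δ(G) > 3n/4 with |A ∪ B| ≤ 4 makes the last sum smaller than n.
module Submission where

open import Defs hiding (sym)

module Counting where

  open import Data.Bool using (Bool; true; false; not; _∧_; T?)
  open import Data.Bool.Properties using (T-≡; ∧-zeroʳ)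
  open import Data.Fin using (Fin; zero; suc; punchOut)
  open import Data.Fin.Properties using (punchIn-punchOut)
  open import Data.Fin.Subset using (Subset; _∈_; _∉_; _∩_; _∪_; ⋂; ∣_∣)
  open import Data.Fin.Subset.Properties using (x∈p∩q⁺; x∈p∩q⁻; p⊆p∪q; q⊆p∪q)
  open import Data.List using (List; []; _∷_; allFin; map; filter)
  import Data.List.Membership.Propositional as List
  open import Data.List.Membership.Propositional.Properties using (∈-allFin; ∈-map∘filter⁻; ∈-map∘filter⁺)
  open import Data.List.Relation.Unary.Any using (here; there)
  open import Data.Nat using (ℕ; zero; suc; _+_; _*_; _≤_; _<_; z≤n; s≤s; s≤s⁻¹; NonZero)
  open import Data.Nat.Properties
  open import Algebra.Properties.Semiring.Sum +-*-semiring
    using (sum; sum-syntax; sum-remove; sum-cong-≗; ∑-distrib-+; ∑-comm; *-distribˡ-sum; *-distribʳ-sum)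
  open import Data.Product using (∃-syntax; _×_; _,_; proj₁)
  open import Data.Vec using ([]; _∷_; lookup)
  open import Data.Vec.Functional using (removeAt)
  open import Data.Vec.Properties using ([]=⇒lookup; lookup⇒[]=; lookup-zipWith; lookup∘tabulate; lookup-replicate)
  open import Function using (_∘_; Equivalence)
  open import Relation.Binary.PropositionalEquality
  open import Relation.Nullary using (contradiction)

  𝟙 : Bool → ℕ
  𝟙 true  = 1
  𝟙 false = 0

  𝟙+𝟙-not≡1 : ∀ b → 𝟙 b + 𝟙 (not b) ≡ 1
  𝟙+𝟙-not≡1 true  = refl
  𝟙+𝟙-not≡1 false = refl

  ∣p∣≡∑𝟙 : ∀ {n} (p : Subset n) → ∣ p ∣ ≡ ∑[ i < n ] 𝟙 (lookup p i)
  ∣p∣≡∑𝟙 []          = refl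
  ∣p∣≡∑𝟙 (true  ∷ p) = cong suc (∣p∣≡∑𝟙 p)
  ∣p∣≡∑𝟙 (false ∷ p) = ∣p∣≡∑𝟙 p

  ∑-const : ∀ n k → ∑[ i < n ] k ≡ n * k
  ∑-const zero    k = refl
  ∑-const (suc n) k = cong (k +_) (∑-const n k)

  ∑-mono-≤ : ∀ {n} {f g : Fin n → ℕ} → (∀ i → f i ≤ g i) → sum f ≤ sum g
  ∑-mono-≤ {zero}  f≤g = z≤n
  ∑-mono-≤ {suc n} f≤g = +-mono-≤ (f≤g zero) (∑-mono-≤ (f≤g ∘ suc))

  term-≤-∑ : ∀ {n} (f : Fin n → ℕ) i → f i ≤ sum f
  term-≤-∑ {suc n} f i = subst (f i ≤_) (sym (sum-remove {i = i} f)) (m≤m+n (f i) _)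

  two-terms-≤-∑ : ∀ {n} (f : Fin n → ℕ) {i j} → i ≢ j → f i + f j ≤ sum f
  two-terms-≤-∑ {suc n} f {i} {j} i≢j = begin
    f i + f j                          ≡⟨ cong (λ k → f i + f k) (punchIn-punchOut i≢j) ⟨
    f i + removeAt f i (punchOut i≢j)  ≤⟨ +-monoʳ-≤ (f i) (term-≤-∑ (removeAt f i) (punchOut i≢j)) ⟩
    f i + sum (removeAt f i)           ≡⟨ sum-remove {i = i} f ⟨
    sum f                              ∎
    where open ≤-Reasoning

  sumOver : ∀ {n} → Subset n → (Fin n → ℕ) → ℕ
  sumOver {n} U f = ∑[ i < n ] (𝟙 (lookup U i) * f i)

  module _ {n} {U : Subset n} (f : Fin n → ℕ) where

    private
      𝟙*-∈ : ∀ {i} → i ∈ U → 𝟙 (lookup U i) * f i ≡ f i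
      𝟙*-∈ i∈U rewrite []=⇒lookup i∈U = +-identityʳ _

    term-≤-sumOver : ∀ {i} → i ∈ U → f i ≤ sumOver U f
    term-≤-sumOver {i} i∈U = subst (_≤ sumOver U f) (𝟙*-∈ i∈U) (term-≤-∑ _ i)

    two-terms-≤-sumOver : ∀ {i j} → i ∈ U → j ∈ U → i ≢ j → f i + f j ≤ sumOver U f
    two-terms-≤-sumOver i∈U j∈U i≢j =
      subst (_≤ sumOver U f) (cong₂ _+_ (𝟙*-∈ i∈U) (𝟙*-∈ j∈U)) (two-terms-≤-∑ _ i≢j)

  sumOver-≤ : ∀ {n k m} (U : Subset n) (f : Fin n → ℕ) .{{_ : NonZero k}} →
              ∣ U ∣ ≤ k → (∀ i → k * f i ≤ m) → sumOver U f ≤ m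
  sumOver-≤ {n} {k} {m} U f ∣U∣≤k kf≤m = *-cancelˡ-≤ k (begin
    k * sumOver U f                          ≡⟨ *-distribˡ-sum k (λ i → 𝟙 (lookup U i) * f i) ⟩
    ∑[ i < n ] (k * (𝟙 (lookup U i) * f i))  ≤⟨ ∑-mono-≤ bound ⟩
    ∑[ i < n ] (𝟙 (lookup U i) * m)          ≡⟨ *-distribʳ-sum m (λ i → 𝟙 (lookup U i)) ⟨
    (∑[ i < n ] 𝟙 (lookup U i)) * m          ≡⟨ cong (_* m) (∣p∣≡∑𝟙 U) ⟨
    ∣ U ∣ * m                                ≤⟨ *-monoˡ-≤ m ∣U∣≤k ⟩
    k * m                                    ∎)
    where
    open ≤-Reasoning
    bound : ∀ i → k * (𝟙 (lookup U i) * f i) ≤ 𝟙 (lookup U i) * m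
    bound i with lookup U i
    ... | true  rewrite *-identityˡ (f i) | *-identityˡ m = kf≤m i
    ... | false = ≤-reflexive (*-zeroʳ k)

  ∑-sumOver-comm : ∀ {m n} (U : Subset m) (f : Fin m → Fin n → ℕ) →
                   ∑[ j < n ] sumOver U (λ i → f i j) ≡ sumOver U (λ i → ∑[ j < n ] f i j)
  ∑-sumOver-comm {m} {n} U f = begin
    ∑[ j < n ] ∑[ i < m ] (𝟙 (lookup U i) * f i j)  ≡⟨ ∑-comm (λ j i → 𝟙 (lookup U i) * f i j) ⟩
    ∑[ i < m ] ∑[ j < n ] (𝟙 (lookup U i) * f i j)  ≡⟨ sum-cong-≗ (λ i → *-distribˡ-sum (𝟙 (lookup U i)) (f i)) ⟨
    ∑[ i < m ] (𝟙 (lookup U i) * ∑[ j < n ] f i j)  ∎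
    where open ≡-Reasoning

  lookup-⋂-false⁻ : ∀ {n} (ps : List (Subset n)) v → lookup (⋂ ps) v ≡ false →
                    ∃[ p ] p List.∈ ps × lookup p v ≡ false
  lookup-⋂-false⁻ []       v ⊤v≡false = contradiction (trans (sym (lookup-replicate v true)) ⊤v≡false) λ ()
  lookup-⋂-false⁻ (p ∷ ps) v ⋂v≡false with lookup p v in pv
  ... | false = p , here refl , pv
  ... | true  = let q , q∈ps , qv = lookup-⋂-false⁻ ps v ⋂psv≡false in q , there q∈ps , qv
    where
    ⋂psv≡false : lookup (⋂ ps) v ≡ false
    ⋂psv≡false = trans (sym (trans (lookup-zipWith _∧_ v p (⋂ ps)) (cong (_∧ _) pv))) ⋂v≡false

  lookup-⋂-false⁺ : ∀ {n} {p} (ps : List (Subset n)) {v} → p List.∈ ps → lookup p v ≡ false →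
                    lookup (⋂ ps) v ≡ false
  lookup-⋂-false⁺ (p ∷ ps) {v} (here refl)  pv = trans (lookup-zipWith _∧_ v p (⋂ ps)) (cong (_∧ _) pv)
  lookup-⋂-false⁺ (p ∷ ps) {v} (there q∈ps) qv =
    trans (lookup-zipWith _∧_ v p (⋂ ps)) (trans (cong (lookup p v ∧_) (lookup-⋂-false⁺ ps q∈ps qv)) (∧-zeroʳ _))

  module _ {n} (G : Graph n) where

    private
      neighbourhoodsOf : Subset n → List (Subset n)
      neighbourhoodsOf S = map (N G) (filter (T? ∘ lookup S) (allFin n))

    commonNbhd-false⁻ : ∀ S v → lookup (commonNbhd G S) v ≡ false → ∃[ s ] s ∈ S × adj G s v ≡ false
    commonNbhd-false⁻ S v eq
      with p , p∈ , pv ← lookup-⋂-false⁻ (neighbourhoodsOf S) v eq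
      with s , _ , refl , s∈S ← ∈-map∘filter⁻ (N G) (T? ∘ lookup S) {f = N G} {xs = allFin n} p∈
      = s , lookup⇒[]= s S (Equivalence.to T-≡ s∈S) , trans (sym (lookup∘tabulate (adj G s) v)) pv

    commonNbhd-false⁺ : ∀ {S s v} → s ∈ S → adj G s v ≡ false → lookup (commonNbhd G S) v ≡ false
    commonNbhd-false⁺ {S} {s} {v} s∈S sv = lookup-⋂-false⁺ (neighbourhoodsOf S)
      (∈-map∘filter⁺ (N G) (T? ∘ lookup S) {f = N G} (s , ∈-allFin s , refl , Equivalence.from T-≡ ([]=⇒lookup s∈S)))
      (trans (lookup∘tabulate (adj G s) v) sv)

    nonDeg : Fin n → ℕ
    nonDeg s = ∑[ v < n ] 𝟙 (not (adj G s v))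

    deg+nonDeg≡n : ∀ s → deg G s + nonDeg s ≡ n
    deg+nonDeg≡n s = begin
      deg G s + nonDeg s                                ≡⟨ cong (_+ nonDeg s) (∣p∣≡∑𝟙 (N G s)) ⟩
      ∑[ v < n ] 𝟙 (lookup (N G s) v) + nonDeg s        ≡⟨ cong (_+ nonDeg s) (sum-cong-≗ (cong 𝟙 ∘ lookup∘tabulate (adj G s))) ⟩
      ∑[ v < n ] 𝟙 (adj G s v) + nonDeg s               ≡⟨ ∑-distrib-+ (𝟙 ∘ adj G s) (𝟙 ∘ not ∘ adj G s) ⟨
      ∑[ v < n ] (𝟙 (adj G s v) + 𝟙 (not (adj G s v)))  ≡⟨ sum-cong-≗ (𝟙+𝟙-not≡1 ∘ adj G s) ⟩
      ∑[ v < n ] 1                                      ≡⟨ ∑-const n 1 ⟩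
      n * 1                                             ≡⟨ *-identityʳ n ⟩
      n                                                 ∎
      where open ≡-Reasoning

    large-deg⇒small-nonDeg : ∀ k s → k * n < suc k * deg G s → suc k * nonDeg s < n
    large-deg⇒small-nonDeg k s kn<[1+k]d = +-cancelʳ-< (k * n) (suc k * j) n (begin-strict
      suc k * j + k * n      <⟨ +-monoʳ-< (suc k * j) kn<[1+k]d ⟩
      suc k * j + suc k * d  ≡⟨ *-distribˡ-+ (suc k) j d ⟨
      suc k * (j + d)        ≡⟨ cong (suc k *_) (trans (+-comm j d) (deg+nonDeg≡n s)) ⟩
      suc k * n              ∎)
      where
      open ≤-Reasoning
      d = deg G s
      j = nonDeg s

    nonNeighboursIn : Subset n → Fin n → ℕ
    nonNeighboursIn U v = sumOver U (λ s → 𝟙 (not (adj G s v)))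

    ∑-nonNeighboursIn : ∀ U → ∑[ v < n ] nonNeighboursIn U v ≡ sumOver U nonDeg
    ∑-nonNeighboursIn U = ∑-sumOver-comm U (λ s v → 𝟙 (not (adj G s v)))

    private
      nonNeighbour-≤ : ∀ {U s v} → s ∈ U → adj G s v ≡ false → 1 ≤ nonNeighboursIn U v
      nonNeighbour-≤ {U} {v = v} s∈U sv =
        subst (λ b → 𝟙 (not b) ≤ nonNeighboursIn U v) sv (term-≤-sumOver (λ s → 𝟙 (not (adj G s v))) s∈U)

    commonNbhd-∩-pointwise : ∀ A B v →
      1 + 𝟙 (lookup (commonNbhd G (A ∩ B)) v) ≤
      𝟙 (lookup (commonNbhd G A) v) + 𝟙 (lookup (commonNbhd G B) v) + nonNeighboursIn (A ∪ B) v
    commonNbhd-∩-pointwise A B v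
      with lookup (commonNbhd G (A ∩ B)) v in x | lookup (commonNbhd G A) v in a | lookup (commonNbhd G B) v in b
    ... | false | _ | _ with s , s∈A∩B , sv ← commonNbhd-false⁻ (A ∩ B) v x =
      ≤-trans (nonNeighbour-≤ (p⊆p∪q B (proj₁ (x∈p∩q⁻ A B s∈A∩B))) sv) (m≤n+m _ _)
    ... | true | true  | true  = s≤s (s≤s z≤n)
    ... | true | false | true  with s , s∈A , sv ← commonNbhd-false⁻ A v a = s≤s (nonNeighbour-≤ (p⊆p∪q B s∈A) sv)
    ... | true | true  | false with t , t∈B , tv ← commonNbhd-false⁻ B v b = s≤s (nonNeighbour-≤ (q⊆p∪q A B t∈B) tv)
    ... | true | false | false with s , s∈A , sv ← commonNbhd-false⁻ A v a | t , t∈B , tv ← commonNbhd-false⁻ B v b =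
      subst₂ (λ b c → 𝟙 (not b) + 𝟙 (not c) ≤ nonNeighboursIn (A ∪ B) v) sv tv
        (two-terms-≤-sumOver (λ s → 𝟙 (not (adj G s v))) (p⊆p∪q B s∈A) (q⊆p∪q A B t∈B) s≢t)
      where
      s∉B : s ∉ B
      s∉B s∈B with () ← trans (sym x) (commonNbhd-false⁺ (x∈p∩q⁺ (s∈A , s∈B)) sv)
      s≢t : s ≢ t
      s≢t refl = s∉B t∈B

    commonNbhd-∩-count : ∀ A B →
      n + ∣ commonNbhd G (A ∩ B) ∣ ≤ ∣ commonNbhd G A ∣ + ∣ commonNbhd G B ∣ + sumOver (A ∪ B) nonDeg
    commonNbhd-∩-count A B = begin
      n + ∣ NX ∣                                 ≡⟨ cong₂ _+_ (trans (sym (*-identityʳ n)) (sym (∑-const n 1))) (∣p∣≡∑𝟙 NX) ⟩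
      ∑[ v < n ] 1 + ∑[ v < n ] 𝟙 (lookup NX v)  ≡⟨ ∑-distrib-+ (λ _ → 1) (𝟙 ∘ lookup NX) ⟨
      ∑[ v < n ] (1 + 𝟙 (lookup NX v))           ≤⟨ ∑-mono-≤ (commonNbhd-∩-pointwise A B) ⟩
      ∑[ v < n ] (𝟙 (lookup NA v) + 𝟙 (lookup NB v) + nonNeighboursIn (A ∪ B) v)
        ≡⟨ ∑-distrib-+ (λ v → 𝟙 (lookup NA v) + 𝟙 (lookup NB v)) (nonNeighboursIn (A ∪ B)) ⟩
      ∑[ v < n ] (𝟙 (lookup NA v) + 𝟙 (lookup NB v)) + ∑[ v < n ] nonNeighboursIn (A ∪ B) v
        ≡⟨ cong₂ _+_ (∑-distrib-+ (𝟙 ∘ lookup NA) (𝟙 ∘ lookup NB)) (∑-nonNeighboursIn (A ∪ B)) ⟩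
      ∑[ v < n ] 𝟙 (lookup NA v) + ∑[ v < n ] 𝟙 (lookup NB v) + sumOver (A ∪ B) nonDeg
        ≡⟨ cong (_+ sumOver (A ∪ B) nonDeg) (cong₂ _+_ (∣p∣≡∑𝟙 NA) (∣p∣≡∑𝟙 NB)) ⟨
      ∣ NA ∣ + ∣ NB ∣ + sumOver (A ∪ B) nonDeg    ∎
      where
      open ≤-Reasoning
      NA NB NX : Subset n
      NA = commonNbhd G A
      NB = commonNbhd G B
      NX = commonNbhd G (A ∩ B)

  commonNbhd-∩-< : ∀ {m} (G : Graph (suc m)) {k} .{{_ : NonZero k}} (A B : Subset (suc m)) →
    ∣ A ∪ B ∣ ≤ k → (∀ s → k * nonDeg G s < suc m) →
    ∣ commonNbhd G (A ∩ B) ∣ < ∣ commonNbhd G A ∣ + ∣ commonNbhd G B ∣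
  commonNbhd-∩-< {m} G A B ∣A∪B∣≤k few = +-cancelʳ-≤ m _ _ (begin
    suc (∣ NX ∣ + m)                              ≡⟨ cong suc (+-comm ∣ NX ∣ m) ⟩
    suc m + ∣ NX ∣                                ≤⟨ commonNbhd-∩-count G A B ⟩
    ∣ NA ∣ + ∣ NB ∣ + sumOver (A ∪ B) (nonDeg G)  ≤⟨ +-monoʳ-≤ (∣ NA ∣ + ∣ NB ∣) sum≤m ⟩
    ∣ NA ∣ + ∣ NB ∣ + m                           ∎)
    where
    open ≤-Reasoning
    NA NB NX : Subset (suc m)
    NA = commonNbhd G A
    NB = commonNbhd G B
    NX = commonNbhd G (A ∩ B)
    sum≤m : sumOver (A ∪ B) (nonDeg G) ≤ m
    sum≤m = sumOver-≤ (A ∪ B) (nonDeg G) ∣A∪B∣≤k (s≤s⁻¹ ∘ few)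

open import Data.Nat using (ℕ; suc; _*_; _<_; _≤_; NonZero)
import Data.Nat as ℕ
open import Data.Nat.Properties using (*-identityʳ; *-comm)
open import Data.Fin using (Fin)
open import Data.Fin.Subset using (Subset; _∩_; _∪_; ∣_∣)
open import Data.Integer using (ℤ; +_)
import Data.Integer as ℤ
import Data.Integer.Properties as ℤ
open import Data.Integer.Tactic.RingSolver using (solve-∀)
open import Data.Rational using (0ℚ; _+_; _-_; -_; _>_; _/_; toℚᵘ)
import Data.Rational as ℚ
import Data.Rational.Properties as ℚ
open import Data.Rational.Unnormalised using (mkℚᵘ; *≡*; *<*)
import Data.Rational.Unnormalised as ℚᵘ
import Data.Rational.Unnormalised.Properties as ℚᵘ
open import Relation.Binary.PropositionalEquality using (_≡_; sym; subst; subst₂)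

open Counting using (nonDeg; large-deg⇒small-nonDeg; commonNbhd-∩-<)

/-distribʳ-+ : ∀ (i j : ℤ) n .{{_ : NonZero n}} → i / n + j / n ≡ (i ℤ.+ j) / n
/-distribʳ-+ i j (suc n) = ℚ.toℚᵘ-injective (begin
  toℚᵘ (i / suc n + j / suc n)            ≈⟨ ℚ.toℚᵘ-homo-+ (i / suc n) (j / suc n) ⟩
  toℚᵘ (i / suc n) ℚᵘ.+ toℚᵘ (j / suc n)  ≈⟨ ℚᵘ.+-cong (ℚ.toℚᵘ-fromℚᵘ (mkℚᵘ i n)) (ℚ.toℚᵘ-fromℚᵘ (mkℚᵘ j n)) ⟩
  mkℚᵘ i n ℚᵘ.+ mkℚᵘ j n                  ≈⟨ *≡* (common-denominator i j (+ suc n)) ⟩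
  mkℚᵘ (i ℤ.+ j) n                        ≈⟨ ℚ.toℚᵘ-fromℚᵘ (mkℚᵘ (i ℤ.+ j) n) ⟨
  toℚᵘ ((i ℤ.+ j) / suc n)                ∎)
  where
  open ℚᵘ.≃-Reasoning
  common-denominator : ∀ i j d → (i ℤ.* d ℤ.+ j ℤ.* d) ℤ.* d ≡ (i ℤ.+ j) ℤ.* (d ℤ.* d)
  common-denominator = solve-∀

/-monoˡ-< : ∀ {i j : ℤ} n .{{_ : NonZero n}} → i ℤ.< j → i / n ℚ.< j / n
/-monoˡ-< {i} {j} (suc n) i<j = ℚ.toℚᵘ-cancel-< (ℚᵘ.<-respˡ-≃ (ℚᵘ.≃-sym (ℚ.toℚᵘ-fromℚᵘ (mkℚᵘ i n)))
  (ℚᵘ.<-respʳ-≃ (ℚᵘ.≃-sym (ℚ.toℚᵘ-fromℚᵘ (mkℚᵘ j n))) (*<* (ℤ.*-monoʳ-<-pos (+ suc n) i<j))))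

+/-cancel-< : ∀ {a b} m n → (+ a) / suc m ℚ.< (+ b) / suc n → a * suc n < b * suc m
+/-cancel-< {a} {b} m n a/m<b/n with ℚᵘ.<-respˡ-≃ (ℚ.toℚᵘ-fromℚᵘ (mkℚᵘ (+ a) m))
  (ℚᵘ.<-respʳ-≃ (ℚ.toℚᵘ-fromℚᵘ (mkℚᵘ (+ b) n)) (ℚ.toℚᵘ-mono-< a/m<b/n))
... | *<* a*n<b*m = ℤ.drop‿+<+ (subst₂ ℤ._<_ (sym (ℤ.pos-* a (suc n))) (sym (ℤ.pos-* b (suc m))) a*n<b*m)

p<q⇒0<q-p : ∀ {p q} → p ℚ.< q → 0ℚ ℚ.< q - p
p<q⇒0<q-p {p} {q} p<q = subst (ℚ._< q - p) (ℚ.+-inverseʳ p) (ℚ.+-monoˡ-< (- p) p<q)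

proposition4p5 : (m : ℕ) (G : Graph (suc m))
    → (∀ (v : Fin (suc m)) → (+ deg G v) / 1 > (+ (3 * suc m)) / 4)
    → (A B : Subset (suc m)) → ∣ A ∪ B ∣ ≤ 4
    → Nhat G A + Nhat G B - Nhat G (A ∩ B) > 0ℚ
proposition4p5 m G δ>3n/4 A B ∣A∪B∣≤4 = p<q⇒0<q-p (begin-strict
  Nhat G (A ∩ B)         <⟨ /-monoˡ-< (suc m) (ℤ.+<+ ∣N[A∩B]∣<a+b) ⟩
  (+ a ℤ.+ + b) / suc m  ≡⟨ /-distribʳ-+ (+ a) (+ b) (suc m) ⟨
  Nhat G A + Nhat G B    ∎)
  where
  open ℚ.≤-Reasoning
  a b : ℕ
  a = ∣ commonNbhd G A ∣
  b = ∣ commonNbhd G B ∣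
  4nonDeg<n : ∀ s → 4 * nonDeg G s < suc m
  4nonDeg<n s = large-deg⇒small-nonDeg G 3 s (subst₂ _<_ (*-identityʳ (3 * suc m)) (*-comm (deg G s) 4)
    (+/-cancel-< {3 * suc m} {deg G s} 3 0 (δ>3n/4 s)))
  ∣N[A∩B]∣<a+b : ∣ commonNbhd G (A ∩ B) ∣ < a ℕ.+ b
  ∣N[A∩B]∣<a+b = commonNbhd-∩-< G A B ∣A∪B∣≤4 4nonDeg<n
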